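{- Let $n = 2^k p^2$, where $p$ is an odd prime and $k$ is a positive integer, be a $2$-near perfect number whose omitted divisors are $1$ and $2^b p^2$ for some integer $b$ with $1 \le b \le k$. Then $n = 36$, and the omitted divisors are $1$ and $18$.
   Context: $\sigma(n)$ denotes the sum of the positive divisors of $n$. A positive integer $n$ is called $2$-near perfect if $\sigma(n) = 2n + d_1 + d_2$ for some two distinct positive divisors $d_1, d_2$ of $n$; these $d_1, d_2$ are called the omitted divisors. -}

module Defs where

open import Data.Nat using (ℕ; suc; _+_; _*_)
open import Data.Nat.Divisibility using (_∣_; _∣?_)
open import Data.List using (List; filter; upTo; map)
open import Data.Nat.ListAction using (sum)
open import Relation.Binary.PropositionalEquality using (_≡_; _≢_)
open import Data.Product using (∃₂; _×_)

divisors : ℕ → List ℕ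
divisors n = filter (_∣? n) (map suc (upTo n))

σ : ℕ → ℕ
σ n = sum (divisors n)

NearPerfect2With : ℕ → ℕ → ℕ → Set
NearPerfect2With n d₁ d₂ =
  d₁ ∣ n × d₂ ∣ n × d₁ ≢ d₂ × σ n ≡ 2 * n + d₁ + d₂

NearPerfect2 : ℕ → Set
NearPerfect2 n = ∃₂ λ d₁ d₂ → NearPerfect2With n d₁ d₂

-- Since p is odd, σ (2 ^ k * p²) = (2 ^ (k + 1) - 1) σ (p²) with σ (p²) = 1 + p + p², both from
-- σ (q ^ (j + 1) * m) = σ m + q σ (q ^ j * m) for a prime q ∤ m: the divisors of q ^ (j + 1) * m
-- not divisible by q are those of m, and the others are q times the divisors of q ^ j * m.
-- Writing 2 ^ (k + 1) = T * B with B = 2 ^ b, the near-perfect condition becomes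
-- T B (1 + p) = (1 + B) p² + 2 + p.  If T < p the right side is too big, T = p forces p ∣ 2,
-- and if T > p then p + 1 ∣ B + 2 (reduce mod p + 1), so B ≥ p - 1, and comparing sizes
-- leaves only p = 3, B = 2, T = 4.
module Submission where

open import Defs
open import Data.Bool using (if_then_else_)
open import Data.List using (_++_; [_]; map; upTo; filter)
open import Data.List.Properties using (filter-++; map-++; upTo-∷ʳ)
open import Data.Nat using (ℕ; zero; suc; _+_; _*_; _^_; _∸_; _%_; _<_; _≤_; NonZero; ≢-nonZero; s≤s; z≤n; z<s)
open import Data.Nat.Coprimality using (Coprime; coprime-divisor)
open import Data.Nat.Divisibility
open import Data.Nat.ListAction using (sum)
open import Data.Nat.ListAction.Properties using (sum-++)
open import Data.Nat.Primality using (Prime; prime[2]; ¬prime[0]; ¬prime[1]; prime⇒irreducible; prime⇒nonZero; euclidsLemma)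
open import Data.Nat.Properties
open import Data.Nat.Tactic.RingSolver using (solve-∀)
open import Data.Product using (_×_; _,_; proj₁; proj₂)
open import Data.Sum using (inj₁; inj₂; [_,_]′)
open import Function using (_∘_)
open import Level using (0ℓ)
open import Relation.Binary using (tri<; tri≈; tri>)
open import Relation.Binary.PropositionalEquality using (_≡_; refl; sym; trans; cong; cong₂; subst; module ≡-Reasoning)
open import Relation.Nullary using (yes; no; does; ¬_; contradiction)
open import Relation.Unary using (Pred; Decidable; _≐_; _⊆_; _∩_; ∁)
open import Relation.Unary.Properties using (_∩?_; ∁?)

private variable
  P Q : Pred ℕ 0ℓ

select : Decidable P → ℕ → ℕ
select P? d = if does (P? d) then d else 0

sumWhere : Decidable P → ℕ → ℕ
sumWhere P? zero = 0
sumWhere P? (suc n) = sumWhere P? n + select P? (suc n)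

sum-filter-upTo : (P? : Decidable P) (n : ℕ) → sum (filter P? (map suc (upTo n))) ≡ sumWhere P? n
sum-filter-upTo P? zero = refl
sum-filter-upTo P? (suc n) = begin
  sum (filter P? (map suc (upTo (suc n))))
    ≡⟨ cong (λ xs → sum (filter P? (map suc xs))) (upTo-∷ʳ n) ⟨
  sum (filter P? (map suc (upTo n ++ [ n ])))
    ≡⟨ cong (sum ∘ filter P?) (map-++ suc (upTo n) [ n ]) ⟩
  sum (filter P? (map suc (upTo n) ++ [ suc n ]))
    ≡⟨ cong sum (filter-++ P? (map suc (upTo n)) [ suc n ]) ⟩
  sum (filter P? (map suc (upTo n)) ++ filter P? [ suc n ])
    ≡⟨ sum-++ (filter P? (map suc (upTo n))) (filter P? [ suc n ]) ⟩
  sum (filter P? (map suc (upTo n))) + sum (filter P? [ suc n ])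
    ≡⟨ cong₂ _+_ (sum-filter-upTo P? n) (sum-filter-singleton (suc n)) ⟩
  sumWhere P? (suc n) ∎
  where
  open ≡-Reasoning
  sum-filter-singleton : ∀ d → sum (filter P? [ d ]) ≡ select P? d
  sum-filter-singleton d with P? d
  ... | yes _ = +-identityʳ d
  ... | no _ = refl

sumWhere-cong : (P? : Decidable P) (Q? : Decidable Q) → P ≐ Q → ∀ n → sumWhere P? n ≡ sumWhere Q? n
sumWhere-cong P? Q? P≐Q zero = refl
sumWhere-cong P? Q? P≐Q (suc n) = cong₂ _+_ (sumWhere-cong P? Q? P≐Q n) select-cong
  where
  select-cong : select P? (suc n) ≡ select Q? (suc n)
  select-cong with P? (suc n) | Q? (suc n)
  ... | yes _ | yes _ = refl
  ... | no _  | no _  = refl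
  ... | yes p | no ¬q = contradiction (proj₁ P≐Q p) ¬q
  ... | no ¬p | yes q = contradiction (proj₂ P≐Q q) ¬p

sumWhere-split : (P? : Decidable P) (Q? : Decidable Q) → ∀ n →
  sumWhere P? n ≡ sumWhere (P? ∩? ∁? Q?) n + sumWhere (P? ∩? Q?) n
sumWhere-split P? Q? zero = refl
sumWhere-split P? Q? (suc n) = begin
  sumWhere P? n + select P? (suc n)
    ≡⟨ cong₂ _+_ (sumWhere-split P? Q? n) select-split ⟩
  (S¬Q n + SQ n) + (select (P? ∩? ∁? Q?) (suc n) + select (P? ∩? Q?) (suc n))
    ≡⟨ interchange (S¬Q n) (SQ n) (select (P? ∩? ∁? Q?) (suc n)) (select (P? ∩? Q?) (suc n)) ⟩
  S¬Q (suc n) + SQ (suc n) ∎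
  where
  open ≡-Reasoning
  S¬Q SQ : ℕ → ℕ
  S¬Q = sumWhere (P? ∩? ∁? Q?)
  SQ = sumWhere (P? ∩? Q?)
  interchange : ∀ a b c d → (a + b) + (c + d) ≡ (a + c) + (b + d)
  interchange = solve-∀
  select-split : select P? (suc n) ≡ select (P? ∩? ∁? Q?) (suc n) + select (P? ∩? Q?) (suc n)
  select-split with P? (suc n) | Q? (suc n)
  ... | yes _ | yes _ = refl
  ... | yes _ | no _  = sym (+-identityʳ (suc n))
  ... | no _  | _     = refl

sumWhere-+-stable : (P? : Decidable P) → ∀ m c → (∀ {i} → i < c → ¬ P (suc (m + i))) →
  sumWhere P? (m + c) ≡ sumWhere P? m
sumWhere-+-stable P? m zero _ = cong (sumWhere P?) (+-identityʳ m)
sumWhere-+-stable P? m (suc c) ¬P rewrite +-suc m c with P? (suc (m + c))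
... | yes p = contradiction p (¬P ≤-refl)
... | no _ = trans (+-identityʳ _) (sumWhere-+-stable P? m c (¬P ∘ m<n⇒m<1+n))

select-∩-accept : (P? : Decidable P) (Q? : Decidable Q) → ∀ {d} → Q d → select (P? ∩? Q?) d ≡ select P? d
select-∩-accept P? Q? {d} q with P? d | Q? d
... | yes _ | yes _ = refl
... | yes _ | no ¬q = contradiction q ¬q
... | no _  | _     = refl

sumWhere-multiples : (P? : Decidable P) → ∀ q .{{_ : NonZero q}} m →
  sumWhere (P? ∩? (q ∣?_)) (q * m) ≡ q * sumWhere (λ e → P? (q * e)) m
sumWhere-multiples P? q zero rewrite *-zeroʳ q = refl
sumWhere-multiples P? q@(suc r) (suc m) = begin
  sumWhere F (q * suc m)
    ≡⟨ cong (sumWhere F) q*[1+m]≡1+q*m+r ⟩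
  sumWhere F (q * m + r) + select F (suc (q * m + r))
    ≡⟨ cong₂ _+_ (sumWhere-+-stable F (q * m) r (λ i<r → no-multiple i<r ∘ proj₂))
                 (cong (select F) (sym q*[1+m]≡1+q*m+r)) ⟩
  sumWhere F (q * m) + select F (q * suc m)
    ≡⟨ cong (sumWhere F (q * m) +_) (select-∩-accept P? (q ∣?_) (m∣m*n (suc m))) ⟩
  sumWhere F (q * m) + select P? (q * suc m)
    ≡⟨ cong₂ _+_ (sumWhere-multiples P? q m) select-multiple ⟩
  q * sumWhere G m + q * select G (suc m)
    ≡⟨ *-distribˡ-+ q (sumWhere G m) (select G (suc m)) ⟨
  q * sumWhere G (suc m) ∎
  where
  open ≡-Reasoning
  F = P? ∩? (q ∣?_)
  G = λ e → P? (q * e)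
  q*[1+m]≡1+q*m+r : q * suc m ≡ suc (q * m + r)
  q*[1+m]≡1+q*m+r = trans (*-suc q m) (cong suc (+-comm r (q * m)))
  no-multiple : ∀ {i} → i < r → q ∤ suc (q * m + i)
  no-multiple {i} i<r q∣ =
    <⇒≱ i<r (≤-pred (∣⇒≤ (∣m+n∣m⇒∣n (subst (q ∣_) (sym (+-suc (q * m) i)) q∣) (m∣m*n m))))
  select-multiple : select P? (q * suc m) ≡ q * select G (suc m)
  select-multiple with P? (q * suc m)
  ... | yes _ = refl
  ... | no _ = sym (*-zeroʳ q)

σ≡sumWhere : ∀ n → σ n ≡ sumWhere (_∣? n) n
σ≡sumWhere n = sum-filter-upTo (_∣? n) n

σ≡sumWhere-≤ : ∀ {n N} .{{_ : NonZero n}} → n ≤ N → σ n ≡ sumWhere (_∣? n) N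
σ≡sumWhere-≤ {n} n≤N with m≤n⇒∃[o]m+o≡n n≤N
... | c , refl = trans (σ≡sumWhere n)
  (sym (sumWhere-+-stable (_∣? n) n c (λ _ d∣n → <⇒≱ (s≤s (m≤m+n n _)) (∣⇒≤ d∣n))))

σ-*-split : ∀ q .{{_ : NonZero q}} m →
  σ (q * m) ≡ sumWhere ((_∣? q * m) ∩? ∁? (q ∣?_)) (q * m) + q * σ m
σ-*-split q m = begin
  σ (q * m)
    ≡⟨ σ≡sumWhere (q * m) ⟩
  sumWhere (_∣? q * m) (q * m)
    ≡⟨ sumWhere-split (_∣? q * m) (q ∣?_) (q * m) ⟩
  S + sumWhere ((_∣? q * m) ∩? (q ∣?_)) (q * m)
    ≡⟨ cong (S +_) (sumWhere-multiples (_∣? q * m) q m) ⟩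
  S + q * sumWhere (λ e → q * e ∣? q * m) m
    ≡⟨ cong (λ s → S + q * s) (sumWhere-cong _ (_∣? m) (*-cancelˡ-∣ q , *-monoʳ-∣ q) m) ⟩
  S + q * sumWhere (_∣? m) m
    ≡⟨ cong (λ s → S + q * s) (σ≡sumWhere m) ⟨
  S + q * σ m ∎
  where
  open ≡-Reasoning
  S = sumWhere ((_∣? q * m) ∩? ∁? (q ∣?_)) (q * m)

σ-*-split-≐ : ∀ q .{{_ : NonZero q}} m c .{{_ : NonZero c}} → c ≤ q * m →
  (_∣ q * m) ∩ ∁ (q ∣_) ≐ (_∣ c) → σ (q * m) ≡ σ c + q * σ m
σ-*-split-≐ q m c c≤q*m divisors≐ = begin
  σ (q * m)
    ≡⟨ σ-*-split q m ⟩
  sumWhere ((_∣? q * m) ∩? ∁? (q ∣?_)) (q * m) + q * σ m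
    ≡⟨ cong (_+ q * σ m) (sumWhere-cong _ (_∣? c) divisors≐ (q * m)) ⟩
  sumWhere (_∣? c) (q * m) + q * σ m
    ≡⟨ cong (_+ q * σ m) (σ≡sumWhere-≤ c≤q*m) ⟨
  σ c + q * σ m ∎
  where open ≡-Reasoning

∤⇒coprime : ∀ {p d} → Prime p → p ∤ d → Coprime d p
∤⇒coprime p-prime p∤d (c∣d , c∣p) with prime⇒irreducible p-prime c∣p
... | inj₁ c≡1 = c≡1
... | inj₂ refl = contradiction c∣d p∤d

coprime-∣-^-* : ∀ {d q x} → Coprime d q → ∀ j → d ∣ q ^ j * x → d ∣ x
coprime-∣-^-* {d} {x = x} _ zero d∣ = subst (d ∣_) (+-identityʳ x) d∣
coprime-∣-^-* {d} {q} {x} cop (suc j) d∣ =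
  coprime-∣-^-* cop j (coprime-divisor cop (subst (d ∣_) (*-assoc q (q ^ j) x) d∣))

prime∤1 : ∀ {p} → Prime p → p ∤ 1
prime∤1 p-prime p∣1 = ¬prime[1] (subst Prime (∣1⇒≡1 p∣1) p-prime)

σ-prime-* : ∀ {q m} → Prime q → q ∤ m → ∀ k → σ (q * (q ^ k * m)) ≡ σ m + q * σ (q ^ k * m)
σ-prime-* {q} {m} q-prime q∤m k = σ-*-split-≐ q (q ^ k * m) m {{m≢0}} m≤ (⇒∣m , ∣m⇒)
  where
  instance
    q≢0 : NonZero q
    q≢0 = prime⇒nonZero q-prime
  m≢0 : NonZero m
  m≢0 = ≢-nonZero (λ m≡0 → q∤m (subst (q ∣_) (sym m≡0) (q ∣0)))
  m≤ : m ≤ q * (q ^ k * m)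
  m≤ = ≤-trans (m≤n*m m (q ^ k) {{m^n≢0 q k}}) (m≤n*m _ q)
  q^[1+k]*m≡ : q ^ suc k * m ≡ q * (q ^ k * m)
  q^[1+k]*m≡ = *-assoc q (q ^ k) m
  ⇒∣m : ((_∣ q * (q ^ k * m)) ∩ ∁ (q ∣_)) ⊆ (_∣ m)
  ⇒∣m {d} (d∣ , q∤d) = coprime-∣-^-* (∤⇒coprime q-prime q∤d) (suc k) (subst (d ∣_) (sym q^[1+k]*m≡) d∣)
  ∣m⇒ : (_∣ m) ⊆ ((_∣ q * (q ^ k * m)) ∩ ∁ (q ∣_))
  ∣m⇒ {d} d∣m = subst (d ∣_) q^[1+k]*m≡ (∣-trans d∣m (n∣m*n (q ^ suc k))) ,
                λ q∣d → q∤m (∣-trans q∣d d∣m)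

σ-prime : ∀ {p} → Prime p → σ p ≡ 1 + p
σ-prime {p} p-prime = begin
  σ p             ≡⟨ cong σ (*-identityʳ p) ⟨
  σ (p * 1)       ≡⟨ σ-prime-* p-prime (prime∤1 p-prime) 0 ⟩
  1 + p * 1       ≡⟨ cong suc (*-identityʳ p) ⟩
  1 + p           ∎
  where open ≡-Reasoning

σ-prime² : ∀ {p} → Prime p → σ (p * p) ≡ 1 + p * (1 + p)
σ-prime² {p} p-prime = begin
  σ (p * p)                 ≡⟨ cong (λ x → σ (p * x)) p^1*1≡p ⟨
  σ (p * (p ^ 1 * 1))       ≡⟨ σ-prime-* p-prime (prime∤1 p-prime) 1 ⟩
  1 + p * σ (p ^ 1 * 1)     ≡⟨ cong (λ x → 1 + p * σ x) p^1*1≡p ⟩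
  1 + p * σ p               ≡⟨ cong (λ x → 1 + p * x) (σ-prime p-prime) ⟩
  1 + p * (1 + p)           ∎
  where
  open ≡-Reasoning
  p^1*1≡p : p ^ 1 * 1 ≡ p
  p^1*1≡p = trans (*-identityʳ (p * 1)) (*-identityʳ p)

σ-prime^*-geometric : ∀ {q m} → Prime q → q ∤ m → ∀ k → (q ∸ 1) * σ (q ^ k * m) + σ m ≡ σ m * q ^ suc k
σ-prime^*-geometric {zero} q-prime = contradiction q-prime ¬prime[0]
σ-prime^*-geometric {q@(suc r)} {m} _ _ zero = begin
  r * σ (1 * m) + σ m   ≡⟨ cong (λ x → r * σ x + σ m) (*-identityˡ m) ⟩
  r * σ m + σ m         ≡⟨ regroup r (σ m) ⟩
  σ m * (q * 1)         ∎
  where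
  open ≡-Reasoning
  regroup : ∀ r s → r * s + s ≡ s * (suc r * 1)
  regroup = solve-∀
σ-prime^*-geometric {q@(suc r)} {m} q-prime q∤m (suc k) = begin
  r * σ (q ^ suc k * m) + σ m     ≡⟨ cong (λ x → r * σ x + σ m) (*-assoc q (q ^ k) m) ⟩
  r * σ (q * (q ^ k * m)) + σ m   ≡⟨ cong (λ x → r * x + σ m) (σ-prime-* q-prime q∤m k) ⟩
  r * (σ m + q * X) + σ m         ≡⟨ regroup r (σ m) X ⟩
  q * (r * X + σ m)               ≡⟨ cong (q *_) (σ-prime^*-geometric q-prime q∤m k) ⟩
  q * (σ m * q ^ suc k)           ≡⟨ *-left-commute q (σ m) (q ^ suc k) ⟩
  σ m * q ^ suc (suc k)           ∎
  where
  open ≡-Reasoning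
  X = σ (q ^ k * m)
  regroup : ∀ r s x → r * (s + suc r * x) + s ≡ suc r * (r * x + s)
  regroup = solve-∀
  *-left-commute : ∀ a b c → a * (b * c) ≡ b * (a * c)
  *-left-commute = solve-∀

odd-prime⇒3≤ : ∀ {p} → Prime p → p % 2 ≡ 1 → 3 ≤ p
odd-prime⇒3≤ {0} p-prime = contradiction p-prime ¬prime[0]
odd-prime⇒3≤ {1} p-prime = contradiction p-prime ¬prime[1]
odd-prime⇒3≤ {2} _ ()
odd-prime⇒3≤ {suc (suc (suc _))} _ _ = s≤s (s≤s (s≤s z≤n))

odd⇒2∤ : ∀ {n} → n % 2 ≡ 1 → 2 ∤ n
odd⇒2∤ {n} odd 2∣n = 0≢1+n (trans (sym (n∣m⇒m%n≡0 n 2 2∣n)) odd)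

odd⇒2∤square : ∀ {n} → n % 2 ≡ 1 → 2 ∤ n * n
odd⇒2∤square {n} odd = [ odd⇒2∤ odd , odd⇒2∤ odd ]′ ∘ euclidsLemma n n prime[2]

-- The factor 1 is (2 ∸ 1) from σ-prime^*-geometric at q = 2.
near-perfect-arithmetic : ∀ {σn} N B q → σn ≡ N * (q * q) + 1 + B * (q * q) →
  1 * σn + (1 + q * (1 + q)) ≡ (1 + q * (1 + q)) * N → N * (1 + q) ≡ (1 + B) * (q * q) + (2 + q)
near-perfect-arithmetic {σn} N B q refl geometric = +-cancelˡ-≡ (N * (q * q)) _ _ (sym (begin
  N * (q * q) + ((1 + B) * (q * q) + (2 + q))   ≡⟨ lhs N B q ⟩
  1 * σn + (1 + q * (1 + q))                    ≡⟨ geometric ⟩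
  (1 + q * (1 + q)) * N                         ≡⟨ rhs N q ⟩
  N * (q * q) + N * (1 + q)                     ∎))
  where
  open ≡-Reasoning
  lhs : ∀ N B q → N * (q * q) + ((1 + B) * (q * q) + (2 + q)) ≡ 1 * (N * (q * q) + 1 + B * (q * q)) + (1 + q * (1 + q))
  lhs = solve-∀
  rhs : ∀ N q → (1 + q * (1 + q)) * N ≡ N * (q * q) + N * (1 + q)
  rhs = solve-∀

diophantine-T<q : ∀ {q T} B → T < q → T * B * (1 + q) < (1 + B) * (q * q) + (2 + q)
diophantine-T<q {T = T} B T<q with m≤n⇒∃[o]m+o≡n T<q
... | r , refl = subst (T * B * (1 + q) <_) (sym (excess T r B)) (m<m+n _ z<s)
  where
  q : ℕ
  q = suc T + r
  excess : ∀ T r B → (1 + B) * ((suc T + r) * (suc T + r)) + (2 + (suc T + r)) ≡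
    T * B * (1 + (suc T + r)) + (2 + (suc T + r) + (B * (1 + r + (suc T + r) * r) + (suc T + r) * (suc T + r)))
  excess = solve-∀

diophantine-T≡q : ∀ {q} B → q * B * (1 + q) ≡ (1 + B) * (q * q) + (2 + q) → q ∣ 2
diophantine-T≡q {q} B eq = ∣m+n∣m⇒∣n (subst (q ∣_) q*B≡ (m∣m*n B)) (m∣m*n (1 + q))
  where
  lhs : ∀ q B → B * (q * q) + q * B ≡ q * B * (1 + q)
  lhs = solve-∀
  rhs : ∀ q B → (1 + B) * (q * q) + (2 + q) ≡ B * (q * q) + (q * (1 + q) + 2)
  rhs = solve-∀
  q*B≡ : q * B ≡ q * (1 + q) + 2
  q*B≡ = +-cancelˡ-≡ (B * (q * q)) _ _ (trans (lhs q B) (trans eq (rhs q B)))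

diophantine-q<T : ∀ {q} u B → (suc q + u) * B * (1 + q) ≡ (1 + B) * (q * q) + (2 + q) →
  B * (1 + 2 * q) + u * B * (1 + q) ≡ q * q + (2 + q)
diophantine-q<T {q} u B eq = +-cancelˡ-≡ (B * (q * q)) _ _ (trans (lhs q u B) (trans eq (rhs q B)))
  where
  lhs : ∀ q u B → B * (q * q) + (B * (1 + 2 * q) + u * B * (1 + q)) ≡ (suc q + u) * B * (1 + q)
  lhs = solve-∀
  rhs : ∀ q B → (1 + B) * (q * q) + (2 + q) ≡ B * (q * q) + (q * q + (2 + q))
  rhs = solve-∀

diophantine-q<T⇒1+q∣2+B : ∀ {q} u B → B * (1 + 2 * q) + u * B * (1 + q) ≡ q * q + (2 + q) → 1 + q ∣ 2 + B
diophantine-q<T⇒1+q∣2+B {q} u B eq = ∣m+n∣m⇒∣n (subst (1 + q ∣_) multiple (m∣m*n (2 * B + u * B))) (m∣m*n q)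
  where
  lhs : ∀ q u B → (1 + q) * (2 * B + u * B) ≡ B * (1 + 2 * q) + u * B * (1 + q) + B
  lhs = solve-∀
  rhs : ∀ q B → q * q + (2 + q) + B ≡ (1 + q) * q + (2 + B)
  rhs = solve-∀
  multiple : (1 + q) * (2 * B + u * B) ≡ (1 + q) * q + (2 + B)
  multiple = trans (lhs q u B) (trans (cong (_+ B) eq) (rhs q B))

-- Here q = 3 + r and B = 2 + r + s; the left side exceeds the right by a sum of monomials.
diophantine-q<T-zeros : ∀ r s u →
  (2 + r + s) * (1 + 2 * (3 + r)) + u * (2 + r + s) * (1 + (3 + r)) ≡ (3 + r) * (3 + r) + (2 + (3 + r)) →
  r ≡ 0 × s ≡ 0 × u ≡ 0
diophantine-q<T-zeros r s u eq =
  m*n≡0⇒m≡0 r 4 (m+n≡0⇒m≡0 (r * 4) excess≡0) ,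
  m*n≡0⇒m≡0 s 7 (m+n≡0⇒m≡0 (s * 7) tail₂) ,
  m*n≡0⇒m≡0 u _ (m+n≡0⇒n≡0 (2 * r * s) tail₃)
  where
  excess : ∀ r s u → (2 + r + s) * (1 + 2 * (3 + r)) + u * (2 + r + s) * (1 + (3 + r)) ≡
    (3 + r) * (3 + r) + (2 + (3 + r)) + (r * 4 + (r * r + (s * 7 + (2 * r * s + u * ((2 + r + s) * (4 + r))))))
  excess = solve-∀
  excess≡0 : r * 4 + (r * r + (s * 7 + (2 * r * s + u * ((2 + r + s) * (4 + r))))) ≡ 0
  excess≡0 = +-cancelˡ-≡ _ _ 0 (trans (sym (excess r s u)) (trans eq (sym (+-identityʳ _))))
  tail₂ : s * 7 + (2 * r * s + u * ((2 + r + s) * (4 + r))) ≡ 0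
  tail₂ = m+n≡0⇒n≡0 (r * r) (m+n≡0⇒n≡0 (r * 4) excess≡0)
  tail₃ : 2 * r * s + u * ((2 + r + s) * (4 + r)) ≡ 0
  tail₃ = m+n≡0⇒n≡0 (s * 7) tail₂

diophantine-q<T-solution : ∀ r u B →
  B * (1 + 2 * (3 + r)) + u * B * (1 + (3 + r)) ≡ (3 + r) * (3 + r) + (2 + (3 + r)) →
  3 + r ≡ 3 × B ≡ 2 × suc (3 + r) + u ≡ 4
diophantine-q<T-solution r u B eq =
  cong (3 +_) r≡0 ,
  trans (sym 2+r+s≡B) (cong₂ (λ r s → 2 + r + s) r≡0 s≡0) ,
  cong₂ (λ r u → 4 + r + u) r≡0 u≡0
  where
  2+r≤B : 2 + r ≤ B
  2+r≤B = ≤-pred (≤-pred (∣⇒≤ (diophantine-q<T⇒1+q∣2+B u B eq)))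
  s : ℕ
  s = proj₁ (m≤n⇒∃[o]m+o≡n 2+r≤B)
  2+r+s≡B : 2 + r + s ≡ B
  2+r+s≡B = proj₂ (m≤n⇒∃[o]m+o≡n 2+r≤B)
  r,s,u≡0 : r ≡ 0 × s ≡ 0 × u ≡ 0
  r,s,u≡0 = diophantine-q<T-zeros r s u
    (subst (λ B → B * (1 + 2 * (3 + r)) + u * B * (1 + (3 + r)) ≡ (3 + r) * (3 + r) + (2 + (3 + r))) (sym 2+r+s≡B) eq)
  r≡0 : r ≡ 0
  r≡0 = proj₁ r,s,u≡0
  s≡0 : s ≡ 0
  s≡0 = proj₁ (proj₂ r,s,u≡0)
  u≡0 : u ≡ 0
  u≡0 = proj₂ (proj₂ r,s,u≡0)

diophantine : ∀ {q T B} → 3 ≤ q → T * B * (1 + q) ≡ (1 + B) * (q * q) + (2 + q) → q ≡ 3 × B ≡ 2 × T ≡ 4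
diophantine {q} {T} {B} 3≤q eq with <-cmp T q
... | tri< T<q _ _ = contradiction eq (<⇒≢ (diophantine-T<q B T<q))
... | tri≈ _ refl _ = contradiction (∣⇒≤ (diophantine-T≡q B eq)) (<⇒≱ 3≤q)
... | tri> _ _ q<T with m≤n⇒∃[o]m+o≡n q<T | m≤n⇒∃[o]m+o≡n 3≤q
...   | u , refl | r , refl = diophantine-q<T-solution r u B (diophantine-q<T {3 + r} u B eq)

near-perfect⇒diophantine : ∀ {p} b e → Prime p → p % 2 ≡ 1 →
  σ (2 ^ (b + e) * (p * p)) ≡ 2 * (2 ^ (b + e) * (p * p)) + 1 + 2 ^ b * (p * p) →
  2 * 2 ^ e * 2 ^ b * (1 + p) ≡ (1 + 2 ^ b) * (p * p) + (2 + p)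
near-perfect⇒diophantine {p} b e p-prime p-odd σ-near-perfect =
  subst (λ N → N * (1 + p) ≡ (1 + 2 ^ b) * (p * p) + (2 + p)) 2^[1+b+e]≡
    (near-perfect-arithmetic (2 ^ suc (b + e)) (2 ^ b) p σ≡ σ-geometric)
  where
  2^[1+b+e]≡ : 2 ^ suc (b + e) ≡ 2 * 2 ^ e * 2 ^ b
  2^[1+b+e]≡ = trans (cong (2 *_) (trans (^-distribˡ-+-* 2 b e) (*-comm (2 ^ b) (2 ^ e))))
                     (sym (*-assoc 2 (2 ^ e) (2 ^ b)))
  σ≡ : σ (2 ^ (b + e) * (p * p)) ≡ 2 ^ suc (b + e) * (p * p) + 1 + 2 ^ b * (p * p)
  σ≡ = trans σ-near-perfect (cong (λ x → x + 1 + 2 ^ b * (p * p)) (sym (*-assoc 2 (2 ^ (b + e)) (p * p))))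
  σ-geometric : 1 * σ (2 ^ (b + e) * (p * p)) + (1 + p * (1 + p)) ≡ (1 + p * (1 + p)) * 2 ^ suc (b + e)
  σ-geometric = subst (λ s → 1 * σ (2 ^ (b + e) * (p * p)) + s ≡ s * 2 ^ suc (b + e)) (σ-prime² p-prime)
    (σ-prime^*-geometric prime[2] (odd⇒2∤square {p} p-odd) (b + e))

proposition12 : (k p b : ℕ) → Prime p → p % 2 ≡ 1 → 1 ≤ k → 1 ≤ b → b ≤ k →
    NearPerfect2With (2 ^ k * (p * p)) 1 (2 ^ b * (p * p)) →
    (2 ^ k * (p * p) ≡ 36) × (2 ^ b * (p * p) ≡ 18)
proposition12 k p b p-prime p-odd _ _ b≤k (_ , _ , _ , σ-near-perfect) with m≤n⇒∃[o]m+o≡n b≤k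
... | e , refl with diophantine {p} {2 * 2 ^ e} {2 ^ b} (odd-prime⇒3≤ p-prime p-odd)
                                (near-perfect⇒diophantine b e p-prime p-odd σ-near-perfect)
...   | refl , 2^b≡2 , 2*2^e≡4 = cong (_* 9) 2^[b+e]≡4 , cong (_* 9) 2^b≡2
  where
  2^[b+e]≡4 : 2 ^ (b + e) ≡ 4
  2^[b+e]≡4 = trans (^-distribˡ-+-* 2 b e) (cong₂ _*_ 2^b≡2 (*-cancelˡ-≡ (2 ^ e) 2 2 2*2^e≡4))
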